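{- Let $T$ be a tree with eigenvalue $\lambda$. Then the set $\mathfrak{C}(T\setminus N^C_\lambda(T))$ of connected components of $T\setminus N^C_\lambda(T)$ is the disjoint union of $\mathfrak{C}(T\setminus N_\lambda(T))$ and a set of trees none of which has $\lambda$ as an eigenvalue.
   Context: Eigenvalues and eigenvectors of a graph are those of its adjacency matrix; an eigenvector for $\lambda$ is a non-zero vector $x$ with $Ax=\lambda x$. $N(T,x)$ is the set of vertices where eigenvector $x$ vanishes; $N_\lambda(T)$ is the set of vertices where every eigenvector of $T$ for $\lambda$ vanishes; $N^C(T,x)$ is the set of vertices of $N(T,x)$ adjacent to at least one vertex outside $N(T,x)$; $N^C_\lambda(T)$ is the union of $N^C(T,x)$ over all eigenvectors $x$ of $T$ for $\lambda$. $G\setminus M$ deletes the vertex set $M$; $\mathfrak{C}(G)$ is the set of connected components of $G$. -}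

module Defs where

open import Level using (0ℓ)
open import Data.Nat using (ℕ; zero; suc; _≥_)
open import Data.Fin using (Fin; zero; suc)
open import Data.Bool using (Bool; true; false; T; if_then_else_)
open import Data.List using (List; []; _∷_; length; last)
open import Data.List.Relation.Unary.Unique.Propositional using (Unique)
open import Data.List.Relation.Unary.Linked using (Linked)
open import Data.List.Relation.Unary.All using (All)
open import Data.Maybe using (Maybe; just; nothing)
open import Data.Product using (Σ; ∃; _×_; _,_)
open import Data.Unit using (⊤)
open import Data.Empty using (⊥)
open import Relation.Nullary using (¬_)
open import Relation.Binary.PropositionalEquality using (_≡_)
open import Relation.Binary.Structures using (IsTotalOrder)
open import Algebra.Structures using (IsCommutativeRing)
open import Function.Bundles using (_⇔_)

-- A model of the real numbers: a complete ordered field.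
-- (Every such structure is isomorphic to ℝ.)

record RealField : Set₁ where
  infix  4 _≈_ _≤_
  infixl 6 _+_
  infixl 7 _*_
  field
    Carrier : Set
    _≈_     : Carrier → Carrier → Set
    _+_     : Carrier → Carrier → Carrier
    _*_     : Carrier → Carrier → Carrier
    -_      : Carrier → Carrier
    0#      : Carrier
    1#      : Carrier
    isCommutativeRing : IsCommutativeRing _≈_ _+_ _*_ -_ 0# 1#
    _⁻¹     : Carrier → Carrier
    ⁻¹-inverse : ∀ x → ¬ (x ≈ 0#) → x * (x ⁻¹) ≈ 1#
    0≉1     : ¬ (0# ≈ 1#)
    _≤_     : Carrier → Carrier → Set
    isTotalOrder : IsTotalOrder _≈_ _≤_
    +-mono-≤ : ∀ {x y} z → x ≤ y → x + z ≤ y + z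
    *-nonneg : ∀ {x y} → 0# ≤ x → 0# ≤ y → 0# ≤ x * y
    complete : (S : Carrier → Set) → (∃ λ x → S x) →
               (∃ λ b → ∀ x → S x → x ≤ b) →
               ∃ λ s → (∀ x → S x → x ≤ s) ×
                       (∀ b → (∀ x → S x → x ≤ b) → s ≤ b)

record Graph (n : ℕ) : Set where
  field
    adj       : Fin n → Fin n → Bool
    adj-sym   : ∀ u v → adj u v ≡ adj v u
    adj-irrefl : ∀ v → adj v v ≡ false

module _ {n : ℕ} (G : Graph n) where
  open Graph G

  Adj : Fin n → Fin n → Set
  Adj u v = T (adj u v)

  VSet : Set₁
  VSet = Fin n → Set

  data Reach (P : VSet) : Fin n → Fin n → Set where
    here : ∀ {u} → P u → Reach P u u
    step : ∀ {u w v} → Reach P u w → Adj w v → P v → Reach P u v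

  Connected : Set
  Connected = ∀ u v → Reach (λ _ → ⊤) u v

  CloseUp : List (Fin n) → Set
  CloseUp []      = ⊥
  CloseUp (v ∷ vs) with last (v ∷ vs)
  ... | just w  = Adj w v
  ... | nothing = ⊥

  IsCycle : List (Fin n) → Set
  IsCycle vs = (length vs ≥ 3) × Unique vs × Linked Adj vs × CloseUp vs

  IsTree : Set
  IsTree = (n ≥ 1) × Connected × (∀ vs → ¬ IsCycle vs)

  -- C is a connected component of G ∖ M
  IsComponent : (M : VSet) → (C : VSet) → Set
  IsComponent M C =
      (∃ λ v → C v)
    × (∀ v → C v → ¬ M v)
    × (∀ u v → C u → C v → Reach C u v)
    × (∀ u v → C u → Adj u v → ¬ M v → C v)

module Spectral (ℝ : RealField) where
  open RealField ℝ

  sumFin : ∀ {m} → (Fin m → Carrier) → Carrier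
  sumFin {zero}  f = 0#
  sumFin {suc m} f = f zero + sumFin (λ i → f (suc i))

  module _ {n : ℕ} (G : Graph n) where
    open Graph G

    A : Fin n → Fin n → Carrier
    A u v = if adj u v then 1# else 0#

    Aact : (Fin n → Carrier) → Fin n → Carrier
    Aact x v = sumFin (λ u → A v u * x u)

    NonZero : (Fin n → Carrier) → Set
    NonZero x = ¬ (∀ v → x v ≈ 0#)

    IsEigenvector : Carrier → (Fin n → Carrier) → Set
    IsEigenvector λ' x = NonZero x × (∀ v → Aact x v ≈ λ' * x v)

    HasEigenvalue : Carrier → Set
    HasEigenvalue λ' = ∃ λ x → IsEigenvector λ' x

    -- eigenvalue of the induced subgraph G[C]: an eigenvector is a
    -- vector supported on C (extended by zero) satisfying the eigen-
    -- equation at the vertices of C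
    InducedHasEigenvalue : (C : Fin n → Set) → Carrier → Set
    InducedHasEigenvalue C λ' = ∃ λ x →
        NonZero x
      × (∀ v → ¬ C v → x v ≈ 0#)
      × (∀ v → C v → Aact x v ≈ λ' * x v)

    Nx : (Fin n → Carrier) → Fin n → Set
    Nx x v = x v ≈ 0#

    Nλ : Carrier → Fin n → Set
    Nλ λ' v = ∀ x → IsEigenvector λ' x → x v ≈ 0#

    NCx : (Fin n → Carrier) → Fin n → Set
    NCx x v = (x v ≈ 0#) × (∃ λ u → Adj G u v × ¬ (x u ≈ 0#))

    NCλ : Carrier → Fin n → Set
    NCλ λ' v = ∃ λ x → IsEigenvector λ' x × NCx x v

VertexSet : ℕ → Set₁
VertexSet n = Fin n → Set

_≐_ : ∀ {n} → (Fin n → Set) → (Fin n → Set) → Set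
C ≐ D = ∀ v → C v ⇔ D v

module Submission where

-- Over a complete ordered field equality with 0 is ¬¬-stable, which lets the classical
-- argument run constructively. If an eigenvector x vanishes at v, its restriction w to the
-- branch of T ∖ v through a neighbour u still satisfies the eigenvalue equation except at v,
-- where (A w) v = x u. Pairing w with any eigenvector y gives y v · x u = 0, so N^C_λ ⊆ N_λ;
-- as N_λ also spreads to every neighbour of a vertex outside N^C_λ, components of T ∖ N_λ are
-- components of T ∖ N^C_λ. Any other component C of T ∖ N^C_λ meets, hence lies inside, N_λ.
-- An eigenvector of T[C] fails the eigenvalue equation of T only at vertices of N^C_λ, and
-- there scaled branch vectors, which vanish on N_λ, repair it: the result is an eigenvector
-- of T that is nonzero somewhere on C ⊆ N_λ, a contradiction.

open import Level using (0ℓ)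
open import Data.Bool using (true; false; T; if_then_else_)
open import Data.Empty using (⊥; ⊥-elim)
open import Data.Fin using (Fin; zero; suc; punchIn; _≟_)
open import Data.Fin.Properties using (punchInᵢ≢i; sequence)
open import Data.List using (List; []; _∷_; length; last)
open import Data.List.Relation.Unary.All using (All; []; _∷_) renaming (map to All-map)
open import Data.List.Relation.Unary.All.Properties using (¬Any⇒All¬)
open import Data.List.Relation.Unary.AllPairs using ([]; _∷_)
open import Data.List.Relation.Unary.Any using (here; there)
open import Data.List.Relation.Unary.Linked using (Linked; [-]; _∷_)
open import Data.List.Relation.Unary.Unique.Propositional using (Unique)
open import Data.Maybe using (just; nothing)
open import Data.Nat using (ℕ; zero; suc)
open import Data.Product using (∃; _×_; _,_; proj₁; proj₂)
open import Data.Sum using (_⊎_; inj₁; inj₂)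
open import Data.Unit using (⊤; tt)
open import Data.Vec.Functional using (Vector; removeAt)
open import Effect.Monad using (RawMonad)
open import Function using (_∘_; case_of_)
open import Relation.Binary.PropositionalEquality as ≡ using (_≡_; _≢_)
open import Relation.Binary.Structures using (IsTotalOrder)
open import Relation.Nullary using (¬_; Dec; yes; no)
open import Relation.Nullary.Decidable using (¬¬-excluded-middle)
open import Relation.Nullary.Negation using (¬¬-Monad; ¬¬-map)
open import Algebra.Bundles using (CommutativeRing)
import Algebra.Definitions.RawMonoid as RawMonoidDefinitions
import Algebra.Properties.CommutativeMonoid.Sum as CommutativeMonoidSum
import Algebra.Properties.Ring as RingProperties
import Algebra.Properties.Semiring.Sum as SemiringSum
open import Tactic.RingSolver.Core.AlmostCommutativeRing using (fromCommutativeRing)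
import Tactic.RingSolver.NonReflective as RingSolver

open import Defs

module RealFieldProperties (ℝ : RealField) where
  open RealField ℝ
  open Spectral ℝ using (sumFin)

  commutativeRing : CommutativeRing 0ℓ 0ℓ
  commutativeRing = record { isCommutativeRing = isCommutativeRing }

  open CommutativeRing commutativeRing public
    using ( setoid; refl; sym; trans; reflexive; +-cong; +-congˡ; +-congʳ; *-congˡ; *-congʳ
          ; +-assoc; +-identityˡ; +-identityʳ; *-identityˡ; *-identityʳ; *-assoc; *-comm
          ; zeroˡ; zeroʳ; -‿inverseˡ; -‿inverseʳ; -‿cong; distribˡ )
  open CommutativeRing commutativeRing using (ring; semiring; +-commutativeMonoid; +-rawMonoid)
  open RingProperties ring public using (+-cancelʳ; -0#≈0#; -1*x≈-x; -‿involutive; xyx⁻¹≈y)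
  open SemiringSum semiring public using (sum; sum-cong-≋; *-distribˡ-sum; *-distribʳ-sum)
  open CommutativeMonoidSum +-commutativeMonoid public
    using (∑-distrib-+; ∑-comm; sum-remove; sum-replicate-zero)
  open RawMonoidDefinitions +-rawMonoid using () renaming (_×_ to _·_)
  open RingSolver (fromCommutativeRing commutativeRing (λ _ → nothing)) public
    using (solve; _⊜_; _⊕_; _⊗_)
  open import Relation.Binary.Reasoning.Setoid setoid public
  private module O = IsTotalOrder isTotalOrder

  ≤-resp : ∀ {a a′ b b′} → a ≈ a′ → b ≈ b′ → a ≤ b → a′ ≤ b′
  ≤-resp a≈a′ b≈b′ = O.≲-respʳ-≈ b≈b′ ∘ O.≲-respˡ-≈ a≈a′

  0≤1 : 0# ≤ 1#
  0≤1 with O.total 0# 1#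
  ... | inj₁ 0≤1 = 0≤1
  ... | inj₂ 1≤0 = O.≲-respʳ-≈ -1*-1≈1 (*-nonneg 0≤-1 0≤-1)
    where
    0≤-1 : 0# ≤ - 1#
    0≤-1 = ≤-resp (-‿inverseʳ 1#) (+-identityˡ (- 1#)) (+-mono-≤ (- 1#) 1≤0)
    -1*-1≈1 : - 1# * - 1# ≈ 1#
    -1*-1≈1 = trans (-1*x≈-x (- 1#)) (-‿involutive 1#)

  ·-zero : ∀ k {a} → a ≈ 0# → k · a ≈ 0#
  ·-zero zero    a≈0 = refl
  ·-zero (suc k) a≈0 = trans (+-cong a≈0 (·-zero k a≈0)) (+-identityˡ 0#)

  ¬¬≈0⇒multiples≤1 : ∀ {a} → ¬ ¬ a ≈ 0# → ∀ z → (∃ λ k → z ≈ k · a) → z ≤ 1#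
  ¬¬≈0⇒multiples≤1 ¬¬a≈0 z (k , z≈ka) with O.total z 1#
  ... | inj₁ z≤1 = z≤1
  ... | inj₂ 1≤z = ⊥-elim (¬¬a≈0 λ a≈0 →
          0≉1 (O.antisym 0≤1 (O.≲-respʳ-≈ (trans z≈ka (·-zero k a≈0)) 1≤z)))

  -- Completeness makes ℝ archimedean: the supremum s of the multiples k · a, bounded by
  -- ¬¬≈0⇒multiples≤1, satisfies s ≤ s - a.
  ¬¬≈0⇒≤0 : ∀ a → ¬ ¬ a ≈ 0# → a ≤ 0#
  ¬¬≈0⇒≤0 a ¬¬a≈0
    with complete (λ z → ∃ λ k → z ≈ k · a) (0# , 0 , refl) (1# , ¬¬≈0⇒multiples≤1 ¬¬a≈0)
  ... | s , s-upper , s-least = ≤-resp s+[a-s]≈a [s-a]+[a-s]≈0 (+-mono-≤ (a + - s) s≤s-a)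
    where
    s-a-upper : ∀ z → (∃ λ k → z ≈ k · a) → z ≤ s + - a
    s-a-upper z (k , z≈ka) =
      ≤-resp (xyx⁻¹≈y a z) refl (+-mono-≤ (- a) (s-upper (a + z) (suc k , +-congˡ z≈ka)))
    s≤s-a : s ≤ s + - a
    s≤s-a = s-least (s + - a) s-a-upper
    s+[a-s]≈a : s + (a + - s) ≈ a
    s+[a-s]≈a = trans (sym (+-assoc s a (- s))) (xyx⁻¹≈y s a)
    [s-a]+[a-s]≈0 : (s + - a) + (a + - s) ≈ 0#
    [s-a]+[a-s]≈0 = begin
      (s + - a) + (a + - s) ≈⟨ solve 4 (λ s a s⁻ a⁻ → ((s ⊕ a⁻) ⊕ (a ⊕ s⁻)) ⊜ ((s ⊕ s⁻) ⊕ (a ⊕ a⁻)))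
                                       refl s a (- s) (- a) ⟩
      (s + - s) + (a + - a) ≈⟨ +-cong (-‿inverseʳ s) (-‿inverseʳ a) ⟩
      0# + 0#               ≈⟨ +-identityˡ 0# ⟩
      0#                    ∎

  ≈0-stable : ∀ a → ¬ ¬ a ≈ 0# → a ≈ 0#
  ≈0-stable a ¬¬a≈0 = O.antisym (¬¬≈0⇒≤0 a ¬¬a≈0) 0≤a
    where
    ¬¬-a≈0 : ¬ ¬ - a ≈ 0#
    ¬¬-a≈0 ¬-a≈0 = ¬¬a≈0 (λ a≈0 → ¬-a≈0 (trans (-‿cong a≈0) -0#≈0#))
    0≤a : 0# ≤ a
    0≤a = ≤-resp (-‿inverseˡ a) (+-identityˡ a) (+-mono-≤ a (¬¬≈0⇒≤0 (- a) ¬¬-a≈0))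

  x*y*y⁻¹≈x : ∀ {x y} → ¬ y ≈ 0# → x * y * y ⁻¹ ≈ x
  x*y*y⁻¹≈x {x} {y} y≉0 =
    trans (*-assoc x y (y ⁻¹)) (trans (*-congˡ (⁻¹-inverse y y≉0)) (*-identityʳ x))

  x*y⁻¹*y≈x : ∀ {x y} → ¬ y ≈ 0# → x * y ⁻¹ * y ≈ x
  x*y⁻¹*y≈x {x} {y} y≉0 =
    trans (*-assoc x (y ⁻¹) y)
          (trans (*-congˡ (trans (*-comm (y ⁻¹) y) (⁻¹-inverse y y≉0))) (*-identityʳ x))

  x*y≈0⇒x≈0 : ∀ {x y} → ¬ y ≈ 0# → x * y ≈ 0# → x ≈ 0#
  x*y≈0⇒x≈0 {x} {y} y≉0 xy≈0 =
    trans (sym (x*y*y⁻¹≈x y≉0)) (trans (*-congʳ xy≈0) (zeroˡ (y ⁻¹)))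

  sumFin≡sum : ∀ {m} (f : Vector Carrier m) → sumFin f ≡ sum f
  sumFin≡sum {zero}  f = ≡.refl
  sumFin≡sum {suc m} f = ≡.cong (f zero +_) (sumFin≡sum (f ∘ suc))

  sum-≈0 : ∀ {m} {f : Vector Carrier m} → (∀ i → f i ≈ 0#) → sum f ≈ 0#
  sum-≈0 {m} f≈0 = trans (sum-cong-≋ f≈0) (sum-replicate-zero m)

  sum-removeAt-cong : ∀ {m} {f g : Vector Carrier (suc m)} k →
                      (∀ i → i ≢ k → f i ≈ g i) → sum (removeAt f k) ≈ sum (removeAt g k)
  sum-removeAt-cong k f≈g = sum-cong-≋ (λ j → f≈g (punchIn k j) (punchInᵢ≢i k j))

  sum-single : ∀ {m} {f : Vector Carrier m} k → (∀ i → i ≢ k → f i ≈ 0#) → sum f ≈ f k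
  sum-single {suc m} {f} k f≈0 = begin
    sum f                     ≈⟨ sum-remove {i = k} f ⟩
    f k + sum (removeAt f k)  ≈⟨ +-congˡ (sum-≈0 (λ j → f≈0 (punchIn k j) (punchInᵢ≢i k j))) ⟩
    f k + 0#                  ≈⟨ +-identityʳ (f k) ⟩
    f k                       ∎

  sum-≈-off⇒≈-at : ∀ {m} {f g : Vector Carrier m} k →
                   (∀ i → i ≢ k → f i ≈ g i) → sum f ≈ sum g → f k ≈ g k
  sum-≈-off⇒≈-at {suc m} {f} {g} k f≈g Σf≈Σg = +-cancelʳ (sum (removeAt g k)) (f k) (g k) (begin
    f k + sum (removeAt g k)  ≈⟨ +-congˡ (sum-removeAt-cong k f≈g) ⟨
    f k + sum (removeAt f k)  ≈⟨ sum-remove {i = k} f ⟨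
    sum f                     ≈⟨ Σf≈Σg ⟩
    sum g                     ≈⟨ sum-remove {i = k} g ⟩
    g k + sum (removeAt g k)  ∎)

  sum-with-defect : ∀ {m} {f g : Vector Carrier m} k {c} →
                    (∀ i → i ≢ k → f i ≈ g i) → f k + c ≈ g k → sum f + c ≈ sum g
  sum-with-defect {suc m} {f} {g} k {c} f≈g fk+c≈gk = begin
    sum f + c                       ≈⟨ +-congʳ (sum-remove {i = k} f) ⟩
    (f k + sum (removeAt f k)) + c  ≈⟨ solve 3 (λ a b c → ((a ⊕ b) ⊕ c) ⊜ ((a ⊕ c) ⊕ b))
                                             refl (f k) (sum (removeAt f k)) c ⟩
    (f k + c) + sum (removeAt f k)  ≈⟨ +-cong fk+c≈gk (sum-removeAt-cong k f≈g) ⟩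
    g k + sum (removeAt g k)        ≈⟨ sum-remove {i = k} g ⟨
    sum g                           ∎

module GraphProperties {n : ℕ} (G : Graph n) where
  open Graph G
  open ≡ using (refl; subst)
  open import Data.Nat using (_≤_; s≤s; z≤n)
  open import Data.List.Membership.DecPropositional (_≟_ {n}) using (_∈_; _∈?_)

  Adj-sym : ∀ {u v} → Adj G u v → Adj G v u
  Adj-sym {u} {v} = subst T (adj-sym u v)

  Adj-irrefl : ∀ {v} → ¬ Adj G v v
  Adj-irrefl {v} = subst T (adj-irrefl v)

  reach-target : ∀ {P a b} → Reach G P a b → P b
  reach-target (here pb)     = pb
  reach-target (step _ _ pb) = pb

  reach-cons : ∀ {P a b c} → P a → Adj G a b → Reach G P b c → Reach G P a c
  reach-cons pa a~b (here pb)       = step (here pa) a~b pb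
  reach-cons pa a~b (step r c~d pd) = step (reach-cons pa a~b r) c~d pd

  reach-sym : ∀ {P a b} → Reach G P a b → Reach G P b a
  reach-sym (here pa)       = here pa
  reach-sym (step r c~b pb) = reach-cons pb (Adj-sym c~b) (reach-sym r)

  reach-trans : ∀ {P a b c} → Reach G P a b → Reach G P b c → Reach G P a c
  reach-trans r (here _)         = r
  reach-trans r (step r′ d~c pc) = step (reach-trans r r′) d~c pc

  -- The vertex list of a walk is stored in reverse: its head is the endpoint.
  data Walk : Fin n → Fin n → List (Fin n) → Set where
    start : ∀ {a} → Walk a a (a ∷ [])
    _▸_   : ∀ {a w b ℓ} → Walk a w ℓ → Adj G w b → Walk a b (b ∷ ℓ)

  SimpleWalk : (Fin n → Set) → Fin n → Fin n → Set
  SimpleWalk P a b = ∃ λ ℓ → Walk a b ℓ × Unique ℓ × All P ℓ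

  shortcut : ∀ {P a w b ℓ} → Walk a w ℓ → Unique ℓ → All P ℓ → b ∈ ℓ → SimpleWalk P a b
  shortcut start   U       Pℓ       (here refl)  = _ , start , U , Pℓ
  shortcut (p ▸ e) U       Pℓ       (here refl)  = _ , p ▸ e , U , Pℓ
  shortcut (p ▸ _) (_ ∷ U) (_ ∷ Pℓ) (there b∈ℓ) = shortcut p U Pℓ b∈ℓ

  simpleWalk : ∀ {P a b} → Reach G P a b → SimpleWalk P a b
  simpleWalk (here pa) = _ , start , [] ∷ [] , pa ∷ []
  simpleWalk {b = b} (step r w~b pb) with simpleWalk r
  ... | ℓ , p , U , Pℓ with b ∈? ℓ
  ...   | yes b∈ℓ = shortcut p U Pℓ b∈ℓ
  ...   | no  b∉ℓ = b ∷ ℓ , p ▸ w~b , ¬Any⇒All¬ ℓ b∉ℓ ∷ U , pb ∷ Pℓ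

  linked-from : ∀ {x a b ℓ} → Adj G x b → Walk a b ℓ → Linked (Adj G) (x ∷ ℓ)
  linked-from x~b start     = x~b ∷ [-]
  linked-from x~b (p ▸ w~b) = x~b ∷ linked-from (Adj-sym w~b) p

  walk-last : ∀ {a b ℓ} x → Walk a b ℓ → last (x ∷ ℓ) ≡ just a
  walk-last x start           = refl
  walk-last x (_▸_ {b = b} p _) = walk-last b p

  walk-closeUp : ∀ {a b ℓ} v → Walk a b ℓ → Adj G a v → CloseUp G (v ∷ ℓ)
  walk-closeUp {ℓ = ℓ} v p a~v with last (v ∷ ℓ) | walk-last v p
  ... | .(just _) | refl = a~v

  -- A walk from u to s avoiding v closes up, through v, to a cycle.
  neighbours-joined-avoiding-≡ : (∀ vs → ¬ IsCycle G vs) → ∀ {v u s} →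
                                 Adj G v u → Adj G v s → Reach G (_≢ v) u s → u ≡ s
  neighbours-joined-avoiding-≡ acyclic {v} {u} {s} v~u v~s u⇝s with u ≟ s
  ... | yes u≡s = u≡s
  ... | no  u≢s with simpleWalk u⇝s
  ...   | ℓ , p , U , ℓ≢v = ⊥-elim (acyclic (v ∷ ℓ)
          (length≥3 p , All-map (λ w≢v v≡w → w≢v (≡.sym v≡w)) ℓ≢v ∷ U , linked-from v~s p ,
           walk-closeUp v p (Adj-sym v~u)))
    where
    length≥3 : ∀ {ℓ} → Walk u s ℓ → 3 ≤ length (v ∷ ℓ)
    length≥3 start         = ⊥-elim (u≢s refl)
    length≥3 (start ▸ _)   = s≤s (s≤s (s≤s z≤n))
    length≥3 ((_ ▸ _) ▸ _) = s≤s (s≤s (s≤s z≤n))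

  first-entry : ∀ {v a b} → a ≢ v → Reach G (λ _ → ⊤) a b →
                Reach G (_≢ v) a b ⊎ ∃ λ w → Reach G (_≢ v) a w × Adj G w v
  first-entry a≢v (here _) = inj₁ (here a≢v)
  first-entry {v} a≢v (step {w = c} {v = b} r c~b _) with first-entry a≢v r
  ... | inj₂ entry = inj₂ entry
  ... | inj₁ a⇝c with b ≟ v
  ...   | yes refl = inj₂ (c , a⇝c , c~b)
  ...   | no  b≢v  = inj₁ (step a⇝c c~b b≢v)

  reached-from-neighbour : Connected G → ∀ {v t} → t ≢ v →
                           ∃ λ w → Adj G v w × Reach G (_≢ v) w t
  reached-from-neighbour connected {v} {t} t≢v with first-entry t≢v (connected t v)
  ... | inj₁ t⇝v             = ⊥-elim (reach-target t⇝v refl)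
  ... | inj₂ (w , t⇝w , w~v) = w , Adj-sym w~v , reach-sym t⇝w

  Branch : Fin n → Fin n → Fin n → Set
  Branch v u = Reach G (_≢ v) u

  branch? : IsTree G → ∀ {v u} → Adj G v u → ∀ t → Dec (Branch v u t)
  branch? (_ , connected , acyclic) {v} {u} v~u t with t ≟ v
  ... | yes refl = no (λ u⇝v → reach-target u⇝v refl)
  ... | no  t≢v with reached-from-neighbour connected t≢v
  ...   | w , v~w , w⇝t with w ≟ u
  ...     | yes refl = yes w⇝t
  ...     | no  w≢u  = no (λ u⇝t → w≢u (≡.sym
              (neighbours-joined-avoiding-≡ acyclic v~u v~w (reach-trans u⇝t (reach-sym w⇝t)))))

module AdjacencyOperator (ℝ : RealField) {n : ℕ} (G : Graph n) where
  open RealField ℝ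
  open RealFieldProperties ℝ
  open Spectral ℝ
  open Graph G

  EigenEqAt : Carrier → Vector Carrier n → Fin n → Set
  EigenEqAt λ' x t = Aact G x t ≈ λ' * x t

  EigenEqWithDefect : Carrier → Fin n → Carrier → Vector Carrier n → Set
  EigenEqWithDefect λ' b c p = (∀ t → t ≢ b → EigenEqAt λ' p t) × (Aact G p b + c ≈ λ' * p b)

  Aact≡sum : ∀ x v → Aact G x v ≡ sum (λ t → A G v t * x t)
  Aact≡sum x v = sumFin≡sum (λ t → A G v t * x t)

  A-sym : ∀ u v → A G u v ≡ A G v u
  A-sym u v = ≡.cong (λ b → if b then 1# else 0#) (adj-sym u v)

  A≈1 : ∀ {v t} → Adj G v t → A G v t ≈ 1#
  A≈1 {v} {t} v~t with adj v t
  ... | true = refl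

  A*-cong : ∀ {v t p q} → (Adj G v t → p ≈ q) → A G v t * p ≈ A G v t * q
  A*-cong {v} {t} {p} {q} p≈q with adj v t
  ... | true  = *-congˡ (p≈q tt)
  ... | false = trans (zeroˡ p) (sym (zeroˡ q))

  Aact-local : ∀ {x y v} → (∀ t → Adj G v t → x t ≈ y t) → Aact G x v ≈ Aact G y v
  Aact-local {x} {y} {v} x≈y = begin
    Aact G x v                  ≡⟨ Aact≡sum x v ⟩
    sum (λ t → A G v t * x t)   ≈⟨ sum-cong-≋ (λ t → A*-cong (x≈y t)) ⟩
    sum (λ t → A G v t * y t)   ≡⟨ Aact≡sum y v ⟨
    Aact G y v                  ∎

  Aact-zero : ∀ v → Aact G (λ _ → 0#) v ≈ 0#
  Aact-zero v = begin
    Aact G (λ _ → 0#) v         ≡⟨ Aact≡sum (λ _ → 0#) v ⟩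
    sum (λ t → A G v t * 0#)    ≈⟨ sum-≈0 (λ t → zeroʳ (A G v t)) ⟩
    0#                          ∎

  Aact-*ˡ : ∀ c x v → Aact G (λ t → c * x t) v ≈ c * Aact G x v
  Aact-*ˡ c x v = begin
    Aact G (λ t → c * x t) v
      ≡⟨ Aact≡sum _ v ⟩
    sum (λ t → A G v t * (c * x t))
      ≈⟨ sum-cong-≋ (λ t → solve 3 (λ a c x → (a ⊗ (c ⊗ x)) ⊜ (c ⊗ (a ⊗ x))) refl (A G v t) c (x t)) ⟩
    sum (λ t → c * (A G v t * x t))
      ≈⟨ *-distribˡ-sum c (λ t → A G v t * x t) ⟨
    c * sum (λ t → A G v t * x t)
      ≡⟨ ≡.cong (c *_) (Aact≡sum x v) ⟨
    c * Aact G x v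
      ∎

  Aact-+ : ∀ x y v → Aact G (λ t → x t + y t) v ≈ Aact G x v + Aact G y v
  Aact-+ x y v = begin
    Aact G (λ t → x t + y t) v
      ≡⟨ Aact≡sum _ v ⟩
    sum (λ t → A G v t * (x t + y t))
      ≈⟨ sum-cong-≋ (λ t → distribˡ (A G v t) (x t) (y t)) ⟩
    sum (λ t → A G v t * x t + A G v t * y t)
      ≈⟨ ∑-distrib-+ (λ t → A G v t * x t) (λ t → A G v t * y t) ⟩
    sum (λ t → A G v t * x t) + sum (λ t → A G v t * y t)
      ≡⟨ ≡.cong₂ _+_ (Aact≡sum x v) (Aact≡sum y v) ⟨
    Aact G x v + Aact G y v
      ∎

  Aact-sum : ∀ {m} (p : Fin m → Vector Carrier n) v →
             Aact G (λ t → sum (λ b → p b t)) v ≈ sum (λ b → Aact G (p b) v)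
  Aact-sum p v = begin
    Aact G (λ t → sum (λ b → p b t)) v
      ≡⟨ Aact≡sum _ v ⟩
    sum (λ t → A G v t * sum (λ b → p b t))
      ≈⟨ sum-cong-≋ (λ t → *-distribˡ-sum (A G v t) (λ b → p b t)) ⟩
    sum (λ t → sum (λ b → A G v t * p b t))
      ≈⟨ ∑-comm (λ t b → A G v t * p b t) ⟩
    sum (λ b → sum (λ t → A G v t * p b t))
      ≈⟨ sum-cong-≋ (λ b → reflexive (≡.sym (Aact≡sum (p b) v))) ⟩
    sum (λ b → Aact G (p b) v)
      ∎

  Aact-self-adjoint : ∀ y w → sum (λ v → y v * Aact G w v) ≈ sum (λ v → Aact G y v * w v)
  Aact-self-adjoint y w = begin
    sum (λ v → y v * Aact G w v)
      ≈⟨ sum-cong-≋ (λ v → reflexive (≡.cong (y v *_) (Aact≡sum w v))) ⟩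
    sum (λ v → y v * sum (λ t → A G v t * w t))
      ≈⟨ sum-cong-≋ (λ v → *-distribˡ-sum (y v) (λ t → A G v t * w t)) ⟩
    sum (λ v → sum (λ t → y v * (A G v t * w t)))
      ≈⟨ ∑-comm (λ v t → y v * (A G v t * w t)) ⟩
    sum (λ t → sum (λ v → y v * (A G v t * w t)))
      ≈⟨ sum-cong-≋ (λ t → sum-cong-≋ (λ v → rearrange t v)) ⟩
    sum (λ t → sum (λ v → A G t v * y v * w t))
      ≈⟨ sum-cong-≋ (λ t → *-distribʳ-sum (w t) (λ v → A G t v * y v)) ⟨
    sum (λ t → sum (λ v → A G t v * y v) * w t)
      ≈⟨ sum-cong-≋ (λ t → reflexive (≡.cong (_* w t) (Aact≡sum y t))) ⟨
    sum (λ t → Aact G y t * w t)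
      ∎
    where
    rearrange : ∀ t v → y v * (A G v t * w t) ≈ A G t v * y v * w t
    rearrange t v = begin
      y v * (A G v t * w t)  ≈⟨ *-assoc (y v) (A G v t) (w t) ⟨
      y v * A G v t * w t    ≈⟨ *-congʳ (*-comm (y v) (A G v t)) ⟩
      A G v t * y v * w t    ≡⟨ ≡.cong (λ a → a * y v * w t) (A-sym v t) ⟩
      A G t v * y v * w t    ∎

  Aact-single-neighbour : ∀ {x v u} → Adj G v u → (∀ t → Adj G v t → t ≢ u → x t ≈ 0#) →
                          Aact G x v ≈ x u
  Aact-single-neighbour {x} {v} {u} v~u others≈0 = begin
    Aact G x v                 ≡⟨ Aact≡sum x v ⟩
    sum (λ t → A G v t * x t)  ≈⟨ sum-single u (λ t t≢u →
                                    trans (A*-cong (λ v~t → others≈0 t v~t t≢u)) (zeroʳ _)) ⟩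
    A G v u * x u              ≈⟨ *-congʳ (A≈1 v~u) ⟩
    1# * x u                   ≈⟨ *-identityˡ (x u) ⟩
    x u                        ∎

  restrict : {P : Fin n → Set} → (∀ t → Dec (P t)) → Vector Carrier n → Vector Carrier n
  restrict P? x t with P? t
  ... | yes _ = x t
  ... | no  _ = 0#

  restrict-inside : ∀ {P : Fin n → Set} (P? : ∀ t → Dec (P t)) (x : Vector Carrier n) {t} →
                    P t → restrict P? x t ≈ x t
  restrict-inside P? x {t} pt with P? t
  ... | yes _  = refl
  ... | no ¬pt = ⊥-elim (¬pt pt)

  restrict-outside : ∀ {P : Fin n → Set} (P? : ∀ t → Dec (P t)) (x : Vector Carrier n) {t} →
                     ¬ P t → restrict P? x t ≈ 0#
  restrict-outside P? x {t} ¬pt with P? t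
  ... | yes pt = ⊥-elim (¬pt pt)
  ... | no _   = refl

module TreeEigenvectors (ℝ : RealField) {n : ℕ} (T : Graph n) (tree : IsTree T) where
  open RealField ℝ
  open RealFieldProperties ℝ
  open Spectral ℝ
  open GraphProperties T
  open AdjacencyOperator ℝ T

  module BranchVector {λ' : Carrier} {x : Vector Carrier n} (x-eigen : ∀ t → EigenEqAt λ' x t)
                      {v u : Fin n} (v~u : Adj T v u) (xv≈0 : x v ≈ 0#) where

    private
      inBranch? : ∀ t → Dec (Branch v u t)
      inBranch? = branch? tree v~u

    branchVector : Vector Carrier n
    branchVector = restrict inBranch? x

    branchVector-at-v : branchVector v ≈ 0#
    branchVector-at-v = restrict-outside inBranch? x (λ u⇝v → reach-target u⇝v ≡.refl)

    branchVector-vanishes : ∀ {t} → x t ≈ 0# → branchVector t ≈ 0#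
    branchVector-vanishes {t} xt≈0 = case inBranch? t of λ where
      (yes u⇝t) → trans (restrict-inside inBranch? x u⇝t) xt≈0
      (no ¬u⇝t) → restrict-outside inBranch? x ¬u⇝t

    branchVector-eigen-inside : ∀ {t} → Branch v u t → EigenEqAt λ' branchVector t
    branchVector-eigen-inside {t} u⇝t = begin
      Aact T branchVector t  ≈⟨ Aact-local agrees ⟩
      Aact T x t             ≈⟨ x-eigen t ⟩
      λ' * x t               ≈⟨ *-congˡ (restrict-inside inBranch? x u⇝t) ⟨
      λ' * branchVector t    ∎
      where
      agrees : ∀ s → Adj T t s → branchVector s ≈ x s
      agrees s t~s = case s ≟ v of λ where
        (yes ≡.refl) → trans branchVector-at-v (sym xv≈0)
        (no s≢v)     → restrict-inside inBranch? x (step u⇝t t~s s≢v)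

    branchVector-eigen-outside : ∀ {t} → t ≢ v → ¬ Branch v u t → EigenEqAt λ' branchVector t
    branchVector-eigen-outside {t} t≢v ¬u⇝t = begin
      Aact T branchVector t  ≈⟨ Aact-local vanishes ⟩
      Aact T (λ _ → 0#) t    ≈⟨ Aact-zero t ⟩
      0#                     ≈⟨ zeroʳ λ' ⟨
      λ' * 0#                ≈⟨ *-congˡ (restrict-outside inBranch? x ¬u⇝t) ⟨
      λ' * branchVector t    ∎
      where
      vanishes : ∀ s → Adj T t s → branchVector s ≈ 0#
      vanishes s t~s = restrict-outside inBranch? x
                         (λ u⇝s → ¬u⇝t (step u⇝s (Adj-sym t~s) t≢v))

    branchVector-eigen : ∀ t → t ≢ v → EigenEqAt λ' branchVector t
    branchVector-eigen t t≢v = case inBranch? t of λ where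
      (yes u⇝t) → branchVector-eigen-inside u⇝t
      (no ¬u⇝t) → branchVector-eigen-outside t≢v ¬u⇝t

    Aact-branchVector-at-v : Aact T branchVector v ≈ x u
    Aact-branchVector-at-v = begin
      Aact T branchVector v  ≈⟨ Aact-single-neighbour v~u other-neighbours ⟩
      branchVector u         ≈⟨ restrict-inside inBranch? x (here u≢v) ⟩
      x u                    ∎
      where
      u≢v : u ≢ v
      u≢v ≡.refl = Adj-irrefl v~u
      other-neighbours : ∀ t → Adj T v t → t ≢ u → branchVector t ≈ 0#
      other-neighbours t v~t t≢u = restrict-outside inBranch? x
        (λ u⇝t → t≢u (≡.sym (neighbours-joined-avoiding-≡ (proj₂ (proj₂ tree)) v~u v~t u⇝t)))

  open BranchVector

  -- ⟨y, A w⟩ = ⟨A y, w⟩ for the branch vector w; the terms agree away from v.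
  NCλ⊆Nλ : ∀ {λ' v} → NCλ T λ' v → Nλ T λ' v
  NCλ⊆Nλ {λ'} {v} (x , (_ , x-eigen) , xv≈0 , u , u~v , xu≉0) y (_ , y-eigen) =
    x*y≈0⇒x≈0 xu≉0 (begin
      y v * x u         ≈⟨ *-congˡ (Aact-branchVector-at-v x-eigen v~u xv≈0) ⟨
      y v * Aact T w v  ≈⟨ sum-≈-off⇒≈-at v terms-agree (Aact-self-adjoint y w) ⟩
      Aact T y v * w v  ≈⟨ *-congˡ (branchVector-at-v x-eigen v~u xv≈0) ⟩
      Aact T y v * 0#   ≈⟨ zeroʳ _ ⟩
      0#                ∎)
    where
    v~u = Adj-sym u~v
    w = branchVector x-eigen v~u xv≈0
    terms-agree : ∀ t → t ≢ v → y t * Aact T w t ≈ Aact T y t * w t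
    terms-agree t t≢v = begin
      y t * Aact T w t   ≈⟨ *-congˡ (branchVector-eigen x-eigen v~u xv≈0 t t≢v) ⟩
      y t * (λ' * w t)   ≈⟨ *-assoc (y t) λ' (w t) ⟨
      y t * λ' * w t     ≈⟨ *-congʳ (trans (*-comm (y t) λ') (sym (y-eigen t))) ⟩
      Aact T y t * w t   ∎

  NCλ-defect-vector : ∀ {λ' b} → NCλ T λ' b → ∀ c →
                      ∃ λ p → EigenEqWithDefect λ' b c p × (∀ t → Nλ T λ' t → p t ≈ 0#)
  NCλ-defect-vector {λ'} {b} (x , x-eigenvector@(_ , x-eigen) , xb≈0 , u , u~b , xu≉0) c =
    p , (p-eigen , p-defect) , p-vanishes
    where
    b~u = Adj-sym u~b
    w = branchVector x-eigen b~u xb≈0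
    κ = - c * x u ⁻¹
    p : Vector Carrier n
    p t = κ * w t
    p-eigen : ∀ t → t ≢ b → EigenEqAt λ' p t
    p-eigen t t≢b = begin
      Aact T p t       ≈⟨ Aact-*ˡ κ w t ⟩
      κ * Aact T w t   ≈⟨ *-congˡ (branchVector-eigen x-eigen b~u xb≈0 t t≢b) ⟩
      κ * (λ' * w t)   ≈⟨ solve 3 (λ k l w → (k ⊗ (l ⊗ w)) ⊜ (l ⊗ (k ⊗ w))) refl κ λ' (w t) ⟩
      λ' * p t         ∎
    p-defect : Aact T p b + c ≈ λ' * p b
    p-defect = begin
      Aact T p b + c      ≈⟨ +-congʳ (Aact-*ˡ κ w b) ⟩
      κ * Aact T w b + c  ≈⟨ +-congʳ (*-congˡ (Aact-branchVector-at-v x-eigen b~u xb≈0)) ⟩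
      κ * x u + c         ≈⟨ +-congʳ (x*y⁻¹*y≈x xu≉0) ⟩
      - c + c             ≈⟨ -‿inverseˡ c ⟩
      0#                  ≈⟨ zeroʳ λ' ⟨
      λ' * 0#             ≈⟨ *-congˡ (zeroʳ κ) ⟨
      λ' * (κ * 0#)       ≈⟨ *-congˡ (*-congˡ (branchVector-at-v x-eigen b~u xb≈0)) ⟨
      λ' * p b            ∎
    p-vanishes : ∀ t → Nλ T λ' t → p t ≈ 0#
    p-vanishes t t∈Nλ =
      trans (*-congˡ (branchVector-vanishes x-eigen b~u xb≈0 (t∈Nλ x x-eigenvector))) (zeroʳ κ)

module Components (ℝ : RealField) {n : ℕ} (T : Graph n) (tree : IsTree T)
                  (λ' : RealField.Carrier ℝ) where
  open RealField ℝ
  open RealFieldProperties ℝ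
  open Spectral ℝ
  open GraphProperties T using (Adj-sym; reach-target)
  open AdjacencyOperator ℝ T
  open TreeEigenvectors ℝ T tree using (NCλ⊆Nλ; NCλ-defect-vector)

  Nλ-spreads : ∀ {a b} → Adj T a b → Nλ T λ' b → ¬ NCλ T λ' b → Nλ T λ' a
  Nλ-spreads {a} {b} a~b b∈Nλ b∉NCλ x x-eigenvector = ≈0-stable (x a) λ xa≉0 →
    b∉NCλ (x , x-eigenvector , b∈Nλ x x-eigenvector , a , a~b , xa≉0)

  component-Nλ⇒component-NCλ : ∀ {C} → IsComponent T (Nλ T λ') C → IsComponent T (NCλ T λ') C
  component-Nλ⇒component-NCλ (inhabited , avoids-Nλ , connected , closed) =
      inhabited
    , (λ v v∈C → avoids-Nλ v v∈C ∘ NCλ⊆Nλ)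
    , connected
    , (λ a b a∈C a~b b∉NCλ → closed a b a∈C a~b λ b∈Nλ →
         avoids-Nλ a a∈C (Nλ-spreads a~b b∈Nλ b∉NCλ))

  component-NCλ-meeting-Nλ⊆Nλ : ∀ {C w} → IsComponent T (NCλ T λ') C → C w → Nλ T λ' w →
                                ∀ c → C c → Nλ T λ' c
  component-NCλ-meeting-Nλ⊆Nλ {C} {w} (_ , avoids-NCλ , connected , _) w∈C w∈Nλ c c∈C =
    spread (connected w c w∈C c∈C)
    where
    spread : ∀ {c} → Reach T C w c → Nλ T λ' c
    spread (here _)                   = w∈Nλ
    spread (step {w = a} w⇝a a~b _) =
      Nλ-spreads (Adj-sym a~b) (spread w⇝a) (avoids-NCλ a (reach-target w⇝a))

  component-NCλ-not-Nλ⇒meets-Nλ : ∀ {C} → IsComponent T (NCλ T λ') C → ¬ IsComponent T (Nλ T λ') C →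
                                  ¬ ¬ ∃ λ w → C w × Nλ T λ' w
  component-NCλ-not-Nλ⇒meets-Nλ (inhabited , _ , connected , closed) not-component avoids-Nλ =
    not-component
      ( inhabited
      , (λ v v∈C v∈Nλ → avoids-Nλ (v , v∈C , v∈Nλ))
      , connected
      , (λ a b a∈C a~b b∉Nλ → closed a b a∈C a~b (b∉Nλ ∘ NCλ⊆Nλ)) )

  module NoInducedEigenvector {C} (component : IsComponent T (NCλ T λ') C)
                              (C⊆Nλ : ∀ c → C c → Nλ T λ' c)
                              {y : Vector Carrier n} (y≉0 : NonZero T y)
                              (y-outside : ∀ v → ¬ C v → y v ≈ 0#)
                              (y-eigen : ∀ v → C v → EigenEqAt λ' y v) where

    residual : Fin n → Carrier
    residual t = Aact T y t + - (λ' * y t)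

    Correction : Fin n → Vector Carrier n → Set
    Correction b p = EigenEqWithDefect λ' b (residual b) p × (∀ c → C c → p c ≈ 0#)

    y≈0-on-C⇒⊥ : (∀ c → C c → y c ≈ 0#) → ⊥
    y≈0-on-C⇒⊥ y≈0 = y≉0 λ v → ≈0-stable (y v) λ yv≉0 →
      yv≉0 (y-outside v λ v∈C → yv≉0 (y≈0 v v∈C))

    residual-split : ∀ t → λ' * y t + residual t ≈ Aact T y t
    residual-split t = trans (sym (+-assoc _ _ _)) (xyx⁻¹≈y (λ' * y t) (Aact T y t))

    residual≈0-on-C : ∀ {b} → C b → residual b ≈ 0#
    residual≈0-on-C {b} b∈C = trans (+-congʳ (y-eigen b b∈C)) (-‿inverseʳ (λ' * y b))

    residual≈0-outside-C∪NCλ : ∀ {b} → ¬ C b → ¬ NCλ T λ' b → residual b ≈ 0#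
    residual≈0-outside-C∪NCλ {b} b∉C b∉NCλ = begin
      Aact T y b + - (λ' * y b)  ≈⟨ +-cong (trans (Aact-local neighbours≈0) (Aact-zero b))
                                          (-‿cong (*-congˡ (y-outside b b∉C))) ⟩
      0# + - (λ' * 0#)           ≈⟨ +-identityˡ _ ⟩
      - (λ' * 0#)                ≈⟨ -‿cong (zeroʳ λ') ⟩
      - 0#                       ≈⟨ -0#≈0# ⟩
      0#                         ∎
      where
      closed = proj₂ (proj₂ (proj₂ component))
      neighbours≈0 : ∀ t → Adj T b t → y t ≈ 0#
      neighbours≈0 t b~t = ≈0-stable (y t) λ yt≉0 →
        yt≉0 (y-outside t λ t∈C → b∉C (closed t b t∈C (Adj-sym b~t) b∉NCλ))

    residual≈0-off-NCλ : ∀ {b} → ¬ NCλ T λ' b → residual b ≈ 0#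
    residual≈0-off-NCλ b∉NCλ = ≈0-stable _ λ r≉0 →
      r≉0 (residual≈0-outside-C∪NCλ (r≉0 ∘ residual≈0-on-C) b∉NCλ)

    correction : ∀ b → Dec (NCλ T λ' b) → ∃ (Correction b)
    correction b (yes b∈NCλ) with NCλ-defect-vector b∈NCλ (residual b)
    ... | p , defect , p-vanishes = p , defect , λ c c∈C → p-vanishes c (C⊆Nλ c c∈C)
    correction b (no b∉NCλ) = (λ _ → 0#) , (zero-eigen , zero-defect) , (λ _ _ → refl)
      where
      zero-eigen : ∀ t → t ≢ b → EigenEqAt λ' (λ _ → 0#) t
      zero-eigen t _ = trans (Aact-zero t) (sym (zeroʳ λ'))
      zero-defect : Aact T (λ _ → 0#) b + residual b ≈ λ' * 0#
      zero-defect = trans (+-cong (Aact-zero b) (residual≈0-off-NCλ b∉NCλ))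
                          (trans (+-identityˡ 0#) (sym (zeroʳ λ')))

    corrections : ¬ ¬ (∀ b → ∃ (Correction b))
    corrections = sequence (RawMonad.rawApplicative ¬¬-Monad)
                           (λ b → ¬¬-map (correction b) ¬¬-excluded-middle)

    corrected-eigenvector⇒⊥ : (∀ b → ∃ (Correction b)) → ⊥
    corrected-eigenvector⇒⊥ cs = y≈0-on-C⇒⊥ λ c c∈C →
      trans (sym (z≈y-on-C c∈C)) (C⊆Nλ c c∈C z (z≉0 , z-eigen))
      where
      p : Fin n → Vector Carrier n
      p b = proj₁ (cs b)
      z : Vector Carrier n
      z t = y t + sum (λ b → p b t)
      z≈y-on-C : ∀ {c} → C c → z c ≈ y c
      z≈y-on-C {c} c∈C =
        trans (+-congˡ (sum-≈0 λ b → proj₂ (proj₂ (cs b)) c c∈C)) (+-identityʳ (y c))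
      z≉0 : NonZero T z
      z≉0 z≈0 = y≈0-on-C⇒⊥ λ c c∈C → trans (sym (z≈y-on-C c∈C)) (z≈0 c)
      z-eigen : ∀ t → EigenEqAt λ' z t
      z-eigen t = begin
        Aact T z t
          ≈⟨ Aact-+ y (λ s → sum (λ b → p b s)) t ⟩
        Aact T y t + Aact T (λ s → sum (λ b → p b s)) t
          ≈⟨ +-congˡ (Aact-sum p t) ⟩
        Aact T y t + Σ
          ≈⟨ +-congʳ (residual-split t) ⟨
        (λ' * y t + residual t) + Σ
          ≈⟨ solve 3 (λ l r Σ → ((l ⊕ r) ⊕ Σ) ⊜ (l ⊕ (Σ ⊕ r))) refl (λ' * y t) (residual t) Σ ⟩
        λ' * y t + (Σ + residual t)
          ≈⟨ +-congˡ (sum-with-defect t off-t at-t) ⟩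
        λ' * y t + sum (λ b → λ' * p b t)
          ≈⟨ +-congˡ (*-distribˡ-sum λ' (λ b → p b t)) ⟨
        λ' * y t + λ' * sum (λ b → p b t)
          ≈⟨ distribˡ λ' (y t) _ ⟨
        λ' * z t
          ∎
        where
        Σ = sum (λ b → Aact T (p b) t)
        off-t : ∀ b → b ≢ t → Aact T (p b) t ≈ λ' * p b t
        off-t b b≢t = proj₁ (proj₁ (proj₂ (cs b))) t (b≢t ∘ ≡.sym)
        at-t : Aact T (p t) t + residual t ≈ λ' * p t t
        at-t = proj₂ (proj₁ (proj₂ (cs t)))

    no-induced-eigenvector : ⊥
    no-induced-eigenvector = corrections corrected-eigenvector⇒⊥

  component-NCλ-not-Nλ⇒¬eigenvalue : ∀ {C} → IsComponent T (NCλ T λ') C →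
                                      ¬ IsComponent T (Nλ T λ') C → ¬ InducedHasEigenvalue T C λ'
  component-NCλ-not-Nλ⇒¬eigenvalue component not-component (y , y≉0 , y-outside , y-eigen) =
    component-NCλ-not-Nλ⇒meets-Nλ component not-component λ (w , w∈C , w∈Nλ) →
      NoInducedEigenvector.no-induced-eigenvector component
        (component-NCλ-meeting-Nλ⊆Nλ component w∈C w∈Nλ) y≉0 y-outside y-eigen

mainTheorem14 : (ℝ : RealField) → (n : ℕ) → (T : Graph n) → IsTree T →
    (λ' : RealField.Carrier ℝ) → Spectral.HasEigenvalue ℝ T λ' →
      ((C : VertexSet n) → IsComponent T (Spectral.Nλ ℝ T λ') C →
         IsComponent T (Spectral.NCλ ℝ T λ') C)
    × ((C : VertexSet n) → IsComponent T (Spectral.NCλ ℝ T λ') C →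
         ¬ IsComponent T (Spectral.Nλ ℝ T λ') C →
         ¬ Spectral.InducedHasEigenvalue ℝ T C λ')
mainTheorem14 ℝ n T tree λ' _ =
    (λ C → component-Nλ⇒component-NCλ)
  , (λ C → component-NCλ-not-Nλ⇒¬eigenvalue)
  where open Components ℝ T tree λ'
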